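{- If $G$ is a connected simple graph on $[n]$ which is a hook-graph, then $G$ is a tree.
   Context: For a simple graph $G$ on $[n]$ with $r$ edges, the Burge array $\mathcal{A}_G=\begin{bmatrix} a_1&\cdots&a_r\\ b_1&\cdots&b_r\end{bmatrix}$ is the unique two-line array whose columns are the edges of $G$, each edge $\{a,b\}$ with $a>b$ written once as a column with top $a$ and bottom $b$, ordered so that $a_1\le\cdots\le a_r$ and $b_k>b_{k+1}$ whenever $a_k=a_{k+1}$. Schensted row insertion $T\leftarrow x$: if $x$ is $\ge$ every entry of row $1$, append $x$ to row $1$; otherwise $x$ replaces the leftmost entry $y>x$ of row $1$, and $y$ is inserted into row $2$ in the same way, etc. Burge correspondence: $T_0=\emptyset$; for $k=1,\dots,r$, form $T_{k-1}\leftarrow b_k$, creating a new cell $(s,t)$ (row $s$, column $t$), then place $a_k$ in cell $(t+1,s)$ if $s\le t$ and in cell $(t,s-1)$ if $s>t$, giving $T_k$. $T_G:=T_r$; the shape of $G$ is the shape of $T_G$. A partition is a hook if its Young diagram has no $2\times2$ square; $G$ is a hook-graph if its shape is a hook. -}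

module Defs where

open import Data.Nat using (ℕ; zero; suc; _∸_; _<ᵇ_; _≤ᵇ_; _≤_; _<_)
open import Data.Bool using (Bool; true; false; if_then_else_)
open import Data.Fin using (Fin; toℕ)
open import Data.List using (List; []; _∷_; [_]; _++_; length; map; reverse; foldl; concatMap; filterᵇ)
open import Data.List.Relation.Unary.Unique.Propositional using (Unique)
open import Data.Maybe using (Maybe; just; nothing)
open import Data.Product using (Σ; _×_; _,_; ∃)
open import Data.Sum using (_⊎_)
open import Data.Empty using (⊥)
open import Data.Unit using (⊤)
open import Relation.Nullary using (¬_)
open import Relation.Binary.PropositionalEquality using (_≡_)
open import Data.List using (allFin)

-- Simple graphs on [n] (vertex i : Fin n stands for the label toℕ i + 1)

record SimpleGraph (n : ℕ) : Set where
  field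
    adj       : Fin n → Fin n → Bool
    symmetric : ∀ u v → adj u v ≡ adj v u
    irreflexive : ∀ v → adj v v ≡ false
open SimpleGraph public

Adj : ∀ {n} → SimpleGraph n → Fin n → Fin n → Set
Adj G u v = adj G u v ≡ true

data Walk {n} (G : SimpleGraph n) : Fin n → Fin n → Set where
  nil  : ∀ {v} → Walk G v v
  cons : ∀ {u v w} → Adj G u v → Walk G v w → Walk G u w

Connected : ∀ {n} → SimpleGraph n → Set
Connected G = ∀ u v → Walk G u v

ClosedChain : ∀ {n} → SimpleGraph n → Fin n → List (Fin n) → Set
ClosedChain G v₀ [] = ⊥
ClosedChain G v₀ (v ∷ []) = Adj G v v₀
ClosedChain G v₀ (u ∷ v ∷ vs) = Adj G u v × ClosedChain G v₀ (v ∷ vs)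

IsCycle : ∀ {n} → SimpleGraph n → List (Fin n) → Set
IsCycle G [] = ⊥
IsCycle G (v₀ ∷ []) = ⊥
IsCycle G (v₀ ∷ v₁ ∷ []) = ⊥
IsCycle G (v₀ ∷ v₁ ∷ v₂ ∷ vs) =
  Unique (v₀ ∷ v₁ ∷ v₂ ∷ vs) × ClosedChain G v₀ (v₀ ∷ v₁ ∷ v₂ ∷ vs)

Acyclic : ∀ {n} → SimpleGraph n → Set
Acyclic G = ∀ cs → ¬ IsCycle G cs

IsTree : ∀ {n} → SimpleGraph n → Set
IsTree G = Connected G × Acyclic G

-- Burge array: columns (a , b), a > b, a weakly increasing, and b strictly
-- decreasing among equal a.  Labels are 1-based.

burgeArray : ∀ {n} → SimpleGraph n → List (ℕ × ℕ)
burgeArray {n} G =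
  concatMap (λ a →
    map (λ b → (suc (toℕ a) , suc (toℕ b)))
        (filterᵇ (λ b → (toℕ b <ᵇ toℕ a) Data.Bool.∧ adj G a b) (reverse (allFin n))))
    (allFin n)

-- Tableaux as lists of rows (row 1 first)

Tableau : Set
Tableau = List (List ℕ)

insertRow : ℕ → List ℕ → List ℕ × Maybe ℕ
insertRow x [] = (x ∷ [] , nothing)
insertRow x (y ∷ ys) with x <ᵇ y
... | true  = (x ∷ ys , just y)
... | false with insertRow x ys
...   | (ys' , m) = (y ∷ ys' , m)

-- Schensted row insertion; also returns the new cell (s , t) (1-based)
insertT : ℕ → Tableau → Tableau × (ℕ × ℕ)
insertT x [] = ((x ∷ []) ∷ [] , (1 , 1))
insertT x (r ∷ rs) with insertRow x r
... | (r' , nothing) = (r' ∷ rs , (1 , length r'))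
... | (r' , just y) with insertT y rs
...   | (rs' , (s , t)) = (r' ∷ rs' , (suc s , t))

-- put a in column j of a row (1-based): overwrite if present, else append
setInRow : ℕ → ℕ → List ℕ → List ℕ
setInRow j a [] = a ∷ []
setInRow zero a (x ∷ xs) = (x ∷ xs) ++ [ a ]
setInRow (suc zero) a (x ∷ xs) = a ∷ xs
setInRow (suc (suc j)) a (x ∷ xs) = x ∷ setInRow (suc j) a xs

setCell : ℕ → ℕ → ℕ → Tableau → Tableau
setCell zero j a T = T
setCell (suc zero) j a [] = (a ∷ []) ∷ []
setCell (suc zero) j a (r ∷ rs) = setInRow j a r ∷ rs
setCell (suc (suc i)) j a [] = [] ∷ setCell (suc i) j a []
setCell (suc (suc i)) j a (r ∷ rs) = r ∷ setCell (suc i) j a rs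

burgeStep : Tableau → ℕ × ℕ → Tableau
burgeStep T (a , b) with insertT b T
... | (T' , (s , t)) = if s ≤ᵇ t then setCell (suc t) s a T' else setCell t (s ∸ 1) a T'

burgeTableau : ∀ {n} → SimpleGraph n → Tableau
burgeTableau G = foldl burgeStep [] (burgeArray G)

shape : ∀ {n} → SimpleGraph n → List ℕ
shape G = map length (burgeTableau G)

HasSquare : List ℕ → Set
HasSquare [] = ⊥
HasSquare (x ∷ []) = ⊥
HasSquare (x ∷ y ∷ rest) = (2 ≤ x × 2 ≤ y) ⊎ HasSquare (y ∷ rest)

IsHook : List ℕ → Set
IsHook λ′ = ¬ HasSquare λ′

IsHookGraph : ∀ {n} → SimpleGraph n → Set
IsHookGraph G = IsHook (shape G)

module Submission where

-- Insert the columns (a, b) of the Burge array one at a time. Either the tableau acquires a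
-- 2×2 square, which it keeps since shapes only grow, or after k columns it has shape (k, 1ᵏ)
-- with first column x < c₁ < ⋯ < c_k, where 1 ≤ x and c_k ≤ n; hence k < n, so a hook-graph
-- on [n] has fewer than n edges. On the other hand a connected graph has at least n − 1 edges,
-- and deleting an edge of a cycle leaves it connected, so a connected graph with a cycle has
-- at least n edges.

open import Defs
open import Data.Bool using (Bool; true; false; _∧_; not; T)
open import Data.Bool.Properties using (T-∧; T-≡)
open import Data.Empty using (⊥-elim)
open import Data.Fin using (Fin; zero; suc; toℕ; _≟_)
open import Data.Fin.Properties using (toℕ<n; toℕ-injective)
open import Data.List using (List; []; _∷_; [_]; _++_; _∷ʳ_; length; map; foldl; reverse; concatMap; filter; filterᵇ; allFin; tabulate)
open import Data.List.Properties using (length-++; length-map; unfold-reverse; filter-notAll)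
open import Data.List.Membership.Propositional using (_∈_)
open import Data.List.Membership.Propositional.Properties using (∈-filter⁺; ∈-allFin; ∈-++⁺ˡ; ∈-++⁺ʳ)
open import Data.List.Relation.Binary.Permutation.Propositional.Properties using (↭-length; filter-↭; ↭-reverse)
import Data.List.Relation.Binary.Pointwise as Pointwise
open import Data.List.Relation.Binary.Prefix.Heterogeneous using (Prefix; []; _∷_)
import Data.List.Relation.Binary.Prefix.Heterogeneous.Properties as Prefix
open import Data.List.Relation.Unary.All as All using (All; []; _∷_; lookupAny)
import Data.List.Relation.Unary.All.Properties as All
open import Data.List.Relation.Unary.AllPairs as AllPairs using (AllPairs; []; _∷_)
import Data.List.Relation.Unary.AllPairs.Properties as AllPairs
open import Data.List.Relation.Unary.Any as Any using (Any; here; there)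
import Data.List.Relation.Unary.Any.Properties as Any
open import Data.Maybe using (Maybe; just; nothing)
open import Data.Nat using (ℕ; zero; suc; _+_; _∸_; _⊓_; _≤_; _<_; _<ᵇ_; _≤ᵇ_; z≤n; s≤s; _<?_)
open import Data.Nat.Properties hiding (_≟_)
open import Data.Nat.Tactic.RingSolver using (solve-∀)
open import Data.Product using (∃-syntax; _×_; _,_; proj₁; swap)
open import Data.Sum using (_⊎_; inj₁; inj₂; [_,_]′)
open import Data.Unit using (tt)
open import Function using (_∘_; flip; id)
open import Function.Bundles using (Equivalence; mk⇔)
open import Relation.Binary.Definitions using (tri<; tri≈; tri>)
open import Relation.Binary.PropositionalEquality using (_≡_; _≢_; refl; sym; trans; cong; cong₂; subst; subst₂; module ≡-Reasoning)
open import Relation.Nullary using (¬_; Dec; does; yes; no; ¬?; _×-dec_; _⊎-dec_)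
open import Relation.Nullary.Decidable using (T?; dec-true; dec-false; does-⇔)
open import Relation.Nullary.Reflects using (ofʸ; ofⁿ)
open import Algebra.Properties.CommutativeMonoid.Sum +-0-commutativeMonoid
  using (sum; sum-syntax; sum-cong-≗; sum-replicate-zero; ∑-distrib-+)

length-∷ʳ : ∀ {A : Set} (xs : List A) x → length (xs ∷ʳ x) ≡ suc (length xs)
length-∷ʳ xs x = trans (length-++ xs) (+-comm (length xs) 1)

length≤length-∷ʳ : ∀ {A : Set} (xs : List A) x → length xs ≤ length (xs ∷ʳ x)
length≤length-∷ʳ xs x = subst (length xs ≤_) (sym (length-∷ʳ xs x)) (n≤1+n _)

all-reverse : ∀ {A : Set} {P : A → Set} {xs} → All P xs → All P (reverse xs)
all-reverse ps = All.tabulate (λ x∈ → All.lookup ps (Any.reverse⁻ x∈))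

allPairs-reverse : ∀ {A : Set} {R : A → A → Set} {xs} → AllPairs R xs → AllPairs (flip R) (reverse xs)
allPairs-reverse [] = []
allPairs-reverse {xs = x ∷ xs} (x~xs ∷ pairs) = subst (AllPairs _) (sym (unfold-reverse x xs))
  (AllPairs.++⁺ (allPairs-reverse pairs) ([] ∷ []) (All.map (_∷ []) (all-reverse x~xs)))

indicator : Bool → ℕ
indicator true = 1
indicator false = 0

indicator-∧-≤ : ∀ p q r → indicator (p ∧ (q ∧ r)) ≤ indicator (p ∧ q)
indicator-∧-≤ false q r = z≤n
indicator-∧-≤ true false r = z≤n
indicator-∧-≤ true true false = z≤n
indicator-∧-≤ true true true = ≤-refl

length-concatMap-tabulate : ∀ {A B : Set} {n} (f : A → List B) (g : Fin n → A) →
                            length (concatMap f (tabulate g)) ≡ ∑[ i < n ] length (f (g i))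
length-concatMap-tabulate {n = zero} f g = refl
length-concatMap-tabulate {n = suc n} f g =
  trans (length-++ (f (g zero))) (cong (length (f (g zero)) +_) (length-concatMap-tabulate f (g ∘ suc)))

length-filterᵇ-tabulate : ∀ {A : Set} {n} (p : A → Bool) (g : Fin n → A) →
                          length (filterᵇ p (tabulate g)) ≡ ∑[ i < n ] indicator (p (g i))
length-filterᵇ-tabulate {n = zero} p g = refl
length-filterᵇ-tabulate {n = suc n} p g with p (g zero)
... | true  = cong suc (length-filterᵇ-tabulate p (g ∘ suc))
... | false = length-filterᵇ-tabulate p (g ∘ suc)

∑-mono-≤ : ∀ {n} {f g : Fin n → ℕ} → (∀ i → f i ≤ g i) → sum f ≤ sum g
∑-mono-≤ {zero} _ = z≤n
∑-mono-≤ {suc n} f≤g = +-mono-≤ (f≤g zero) (∑-mono-≤ (f≤g ∘ suc))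

∑-mono-< : ∀ {n} {f g : Fin n → ℕ} → (∀ i → f i ≤ g i) → ∀ i → f i < g i → sum f < sum g
∑-mono-< f≤g zero fi<gi = +-mono-<-≤ fi<gi (∑-mono-≤ (f≤g ∘ suc))
∑-mono-< f≤g (suc i) fi<gi = +-mono-≤-< (f≤g zero) (∑-mono-< (f≤g ∘ suc) i fi<gi)

_++ʷ_ : ∀ {n} {G : SimpleGraph n} {u v w} → Walk G u v → Walk G v w → Walk G u w
nil ++ʷ q = q
cons e p ++ʷ q = cons e (p ++ʷ q)

reverseʷ : ∀ {n} {G : SimpleGraph n} {u v} → Walk G u v → Walk G v u
reverseʷ nil = nil
reverseʷ {G = G} (cons {u} {v} e p) = reverseʷ p ++ʷ cons (trans (symmetric G v u) e) nil

-- Shapes under Burge insertion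

_⊑_ : List ℕ → List ℕ → Set
_⊑_ = Prefix _≤_

⊑-refl : ∀ λ′ → λ′ ⊑ λ′
⊑-refl λ′ = Prefix.fromPointwise (Pointwise.refl ≤-refl)

⊑-trans : ∀ {λ′ μ ν} → λ′ ⊑ μ → μ ⊑ ν → λ′ ⊑ ν
⊑-trans = Prefix.trans ≤-trans

hasSquare-mono : ∀ {λ′ μ} → λ′ ⊑ μ → HasSquare λ′ → HasSquare μ
hasSquare-mono (p ∷ q ∷ _) (inj₁ (2≤p , 2≤q)) = inj₁ (≤-trans 2≤p p , ≤-trans 2≤q q)
hasSquare-mono (_ ∷ le@(_ ∷ _)) (inj₂ sq) = inj₂ (hasSquare-mono le sq)

data RowInsertion (b : ℕ) : List ℕ → List ℕ × Maybe ℕ → Set where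
  appended : ∀ {r} → All (_≤ b) r → RowInsertion b r (r ∷ʳ b , nothing)
  bumped   : ∀ {x xs xs′ y} → b < y → y ∈ x ∷ xs → length xs′ ≡ length xs →
             RowInsertion b (x ∷ xs) (x ⊓ b ∷ xs′ , just y)

rowInsertion : ∀ b r → RowInsertion b r (insertRow b r)
rowInsertion b [] = appended []
rowInsertion b (x ∷ xs) with b <ᵇ x | <ᵇ-reflects-< b x
... | true | ofʸ b<x =
  subst (λ h → RowInsertion b (x ∷ xs) (h ∷ xs , just x)) (m≥n⇒m⊓n≡n (<⇒≤ b<x)) (bumped b<x (here refl) refl)
... | false | ofⁿ b≮x with insertRow b xs | rowInsertion b xs
...   | _ | appended all = appended (≮⇒≥ b≮x ∷ all)
...   | _ | bumped b<y y∈ len =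
  subst (λ h → RowInsertion b (x ∷ xs) (h ∷ _ , just _)) (m≤n⇒m⊓n≡m (≮⇒≥ b≮x)) (bumped b<y (there y∈) (cong suc len))

insertRow-length : ∀ b r → length r ≤ length (proj₁ (insertRow b r))
insertRow-length b r with insertRow b r | rowInsertion b r
... | _ | appended _ = length≤length-∷ʳ r b
... | _ | bumped _ _ len = s≤s (≤-reflexive (sym len))

insertT-⊑ : ∀ x T → map length T ⊑ map length (proj₁ (insertT x T))
insertT-⊑ x [] = []
insertT-⊑ x (r ∷ rs) with insertRow x r | insertRow-length x r
... | (r′ , nothing) | r≤r′ = r≤r′ ∷ ⊑-refl (map length rs)
... | (r′ , just y) | r≤r′ with insertT y rs | insertT-⊑ y rs
...   | (rs′ , _) | rs⊑rs′ = r≤r′ ∷ rs⊑rs′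

setInRow-length : ∀ j a r → length r ≤ length (setInRow j a r)
setInRow-length j a [] = z≤n
setInRow-length zero a (x ∷ xs) = length≤length-∷ʳ (x ∷ xs) a
setInRow-length (suc zero) a (x ∷ xs) = ≤-refl
setInRow-length (suc (suc j)) a (x ∷ xs) = s≤s (setInRow-length (suc j) a xs)

setCell-⊑ : ∀ i j a T → map length T ⊑ map length (setCell i j a T)
setCell-⊑ zero j a T = ⊑-refl (map length T)
setCell-⊑ (suc zero) j a [] = []
setCell-⊑ (suc zero) j a (r ∷ rs) = setInRow-length j a r ∷ ⊑-refl (map length rs)
setCell-⊑ (suc (suc i)) j a [] = []
setCell-⊑ (suc (suc i)) j a (r ∷ rs) = ≤-refl ∷ setCell-⊑ (suc i) j a rs

burgeStep-⊑ : ∀ T c → map length T ⊑ map length (burgeStep T c)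
burgeStep-⊑ T (a , b) with insertT b T | insertT-⊑ b T
... | (T′ , (s , t)) | T⊑T′ with s ≤ᵇ t
...   | true  = ⊑-trans T⊑T′ (setCell-⊑ (suc t) s a T′)
...   | false = ⊑-trans T⊑T′ (setCell-⊑ t (s ∸ 1) a T′)

burgeSteps-hasSquare : ∀ T cs → HasSquare (map length T) → HasSquare (map length (foldl burgeStep T cs))
burgeSteps-hasSquare T [] sq = sq
burgeSteps-hasSquare T (c ∷ cs) sq = burgeSteps-hasSquare (burgeStep T c) cs (hasSquare-mono (burgeStep-⊑ T c) sq)

-- Hooks of shape (k, 1ᵏ)

AscendingTo : ℕ → List ℕ → ℕ → Set
AscendingTo x [] a = x ≤ a
AscendingTo x (c ∷ cs) a = x < c × AscendingTo c cs a

ascendingTo-length : ∀ {x} cs {a} → AscendingTo x cs a → x + length cs ≤ a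
ascendingTo-length {x} [] {a} x≤a = subst (_≤ a) (sym (+-identityʳ x)) x≤a
ascendingTo-length {x} (c ∷ cs) {a} (x<c , asc) =
  subst (_≤ a) (sym (+-suc x (length cs))) (≤-trans (+-monoˡ-≤ (length cs) x<c) (ascendingTo-length cs asc))

ascendingTo-∷ʳ : ∀ {x} cs {a a′} → AscendingTo x cs a → a < a′ → AscendingTo x (cs ∷ʳ a′) a′
ascendingTo-∷ʳ [] x≤a a<a′ = ≤-<-trans x≤a a<a′ , ≤-refl
ascendingTo-∷ʳ (c ∷ cs) (x<c , asc) a<a′ = x<c , ascendingTo-∷ʳ cs asc a<a′

ascendingTo-weaken : ∀ {x} cs {a a′} → AscendingTo x cs a → a ≤ a′ → AscendingTo x cs a′
ascendingTo-weaken [] x≤a a≤a′ = ≤-trans x≤a a≤a′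
ascendingTo-weaken (c ∷ cs) (x<c , asc) a≤a′ = x<c , ascendingTo-weaken cs asc a≤a′

column : List ℕ → Tableau
column = map [_]

insertT-column-shift : ∀ {y a} cs → AscendingTo y cs a → insertT y (column cs) ≡ (column (y ∷ cs) , (suc (length cs) , 1))
insertT-column-shift [] _ = refl
insertT-column-shift {y} (c ∷ cs) (y<c , asc) with y <ᵇ c | <⇒<ᵇ y<c
... | true | _ rewrite insertT-column-shift cs asc = refl

insertT-column-stop : ∀ {y c} cs → c ≤ y → insertT y (column (c ∷ cs)) ≡ ((c ∷ y ∷ []) ∷ column cs , (1 , 2))
insertT-column-stop {y} {c} cs c≤y with y <ᵇ c | <ᵇ⇒< y c
... | true  | y<c = ⊥-elim (<⇒≱ (y<c _) c≤y)
... | false | _ = refl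

setCell-column : ∀ a cs → setCell (suc (length cs)) 1 a (column cs) ≡ column (cs ∷ʳ a)
setCell-column a [] = refl
setCell-column a (c ∷ cs) = cong ([ c ] ∷_) (setCell-column a cs)

setInRow-∷ʳ : ∀ a r → setInRow (suc (length r)) a r ≡ r ∷ʳ a
setInRow-∷ʳ a [] = refl
setInRow-∷ʳ a (x ∷ []) = refl
setInRow-∷ʳ a (x ∷ y ∷ r) = cong (x ∷_) (setInRow-∷ʳ a (y ∷ r))

burgeStep-appended : ∀ {b r} cs a → insertRow b r ≡ (r ∷ʳ b , nothing) → length r ≡ length cs →
                     burgeStep (r ∷ column cs) (a , b) ≡ (r ∷ʳ b) ∷ column (cs ∷ʳ a)
burgeStep-appended {b} {r} cs a ins len rewrite ins | length-∷ʳ r b | len = cong (r ∷ʳ b ∷_) (setCell-column a cs)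

burgeStep-shifted : ∀ {b r r′ y a′} cs a → insertRow b r ≡ (r′ , just y) → AscendingTo y cs a′ → length r′ ≡ length cs →
                    burgeStep (r ∷ column cs) (a , b) ≡ (r′ ∷ʳ a) ∷ column (y ∷ cs)
burgeStep-shifted {r′ = r′} cs a ins asc len rewrite ins | insertT-column-shift cs asc | sym len =
  cong (_∷ column (_ ∷ cs)) (setInRow-∷ʳ a r′)

burgeStep-stopped : ∀ {b r r′ y c c′} cs a → insertRow b r ≡ (r′ , just y) → c ≤ y →
                    burgeStep (r ∷ column (c ∷ c′ ∷ cs)) (a , b) ≡ r′ ∷ (c ∷ y ∷ []) ∷ (c′ ∷ a ∷ []) ∷ column cs
burgeStep-stopped {c′ = c′} cs a ins c≤y rewrite ins | insertT-column-stop (c′ ∷ cs) c≤y = refl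

BurgeBefore : ℕ × ℕ → ℕ × ℕ → Set
BurgeBefore (a , b) (a′ , b′) = a < a′ ⊎ (a ≡ a′ × b′ < b)

EdgeColumn : ℕ → ℕ × ℕ → Set
EdgeColumn n (a , b) = 0 < b × b < a × a ≤ n

-- The tableau after k columns, the last one being (a , b).
data BurgeHook (k a b : ℕ) : Tableau → Set where
  burgeHook : ∀ {x xs cs} → suc (length xs) ≡ k → length cs ≡ k → AscendingTo 0 (x ∷ cs) a →
              Any (b ≤_) (x ∷ xs) → BurgeHook k a b ((x ∷ xs) ∷ column cs)

burgeHook-bound : ∀ {k a b T} → BurgeHook k a b T → suc k ≤ a
burgeHook-bound (burgeHook {x} {cs = cs} _ refl asc _) = ascendingTo-length (x ∷ cs) asc

∈-∷⇒head : ∀ {y x : ℕ} {xs} → y ∈ x ∷ xs → length xs ≡ 0 → y ≡ x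
∈-∷⇒head (here y≡x) _ = y≡x
∈-∷⇒head {xs = _ ∷ _} (there _) ()

burgeStep-hook : ∀ {k a₀ b₀ a b T} → BurgeHook k a₀ b₀ T → BurgeBefore (a₀ , b₀) (a , b) → 0 < b → b < a →
                 HasSquare (map length (burgeStep T (a , b))) ⊎ BurgeHook (suc k) a b (burgeStep T (a , b))
burgeStep-hook {a₀ = a₀} {b₀} {a} {b} (burgeHook {x} {xs} {c ∷ cs} row refl (0<x , x<c , asc) b₀≤row) before 0<b b<a =
  byRow refl (rowInsertion b (x ∷ xs))
  where
  k : ℕ
  k = suc (length cs)

  a₀≤a : a₀ ≤ a
  a₀≤a = [ <⇒≤ , (λ (a₀≡a , _) → ≤-reflexive a₀≡a) ]′ before

  byRow : ∀ {p} → insertRow b (x ∷ xs) ≡ p → RowInsertion b (x ∷ xs) p →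
          HasSquare (map length (burgeStep ((x ∷ xs) ∷ column (c ∷ cs)) (a , b))) ⊎
          BurgeHook (suc k) a b (burgeStep ((x ∷ xs) ∷ column (c ∷ cs)) (a , b))
  byRow ins (appended row≤b) =
    inj₂ (subst (BurgeHook (suc k) a b) (sym (burgeStep-appended (c ∷ cs) a ins row)) appendedHook)
    where
    -- Equal tops would force b < b₀, yet b₀ is at most some entry of row 1, which is at most b.
    a₀<a : a₀ < a
    a₀<a = [ id , (λ (_ , b<b₀) → let (e≤b , b₀≤e) = lookupAny row≤b b₀≤row in ⊥-elim (<⇒≱ b<b₀ (≤-trans b₀≤e e≤b))) ]′ before

    appendedHook : BurgeHook (suc k) a b ((x ∷ xs ∷ʳ b) ∷ column (c ∷ cs ∷ʳ a))
    appendedHook = burgeHook (cong suc (trans (length-∷ʳ xs b) row)) (length-∷ʳ (c ∷ cs) a)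
      (0<x , ascendingTo-∷ʳ (c ∷ cs) (x<c , asc) a₀<a) (there (Any.++⁺ʳ xs (here ≤-refl)))
  byRow ins (bumped {xs′ = xs′} {y} b<y y∈row len) with y <? c
  ... | yes y<c =
    inj₂ (subst (BurgeHook (suc k) a b) (sym (burgeStep-shifted (c ∷ cs) a ins (y<c , asc) len′)) shiftedHook)
    where
    len′ : suc (length xs′) ≡ k
    len′ = trans (cong suc len) row

    shiftedHook : BurgeHook (suc k) a b ((x ⊓ b ∷ xs′ ∷ʳ a) ∷ column (y ∷ c ∷ cs))
    shiftedHook = burgeHook (cong suc (trans (length-∷ʳ xs′ a) len′)) refl
      (⊓-glb 0<x 0<b , ≤-<-trans (m⊓n≤n x b) b<y , y<c , ascendingTo-weaken cs asc a₀≤a)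
      (there (Any.++⁺ʳ xs′ (here (<⇒≤ b<a))))
  ... | no y≮c = inj₁ (stopped cs row)
    where
    stopped : ∀ ds → suc (length xs) ≡ suc (length ds) → HasSquare (map length (burgeStep ((x ∷ xs) ∷ column (c ∷ ds)) (a , b)))
    stopped [] len₁ = ⊥-elim (y≮c (subst (_< c) (sym (∈-∷⇒head y∈row (suc-injective len₁))) x<c))
    stopped (_ ∷ ds) _ =
      subst HasSquare (sym (cong (map length) (burgeStep-stopped ds a ins (≮⇒≥ y≮c)))) (inj₂ (inj₁ (≤-refl , ≤-refl)))

burgeSteps-bound : ∀ {n k a b T} rest → BurgeHook k a b T → AllPairs BurgeBefore ((a , b) ∷ rest) →
                  All (EdgeColumn n) rest → a ≤ n → IsHook (map length (foldl burgeStep T rest)) → k + length rest < n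
burgeSteps-bound {n} {k} [] hook _ _ a≤n _ =
  subst (_< n) (sym (+-identityʳ k)) (≤-trans (burgeHook-bound hook) a≤n)
burgeSteps-bound {n} {k} (_ ∷ rest) hook ((before ∷ _) ∷ sorted) ((0<b , b<a , a≤n) ∷ valid) _ noSquare
  with burgeStep-hook hook before 0<b b<a
... | inj₁ square = ⊥-elim (noSquare (burgeSteps-hasSquare _ rest square))
... | inj₂ hook′ = subst (_< n) (sym (+-suc k (length rest))) (burgeSteps-bound rest hook′ sorted valid a≤n noSquare)

hookArray-length< : ∀ {n} arr → AllPairs BurgeBefore arr → All (EdgeColumn n) arr →
                    IsHook (map length (foldl burgeStep [] arr)) → 0 < n → length arr < n
hookArray-length< [] _ _ _ 0<n = 0<n
hookArray-length< (_ ∷ rest) sorted ((0<b , b<a , a≤n) ∷ valid) noSquare _ =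
  burgeSteps-bound rest (burgeHook refl refl (0<b , b<a , ≤-refl) (here ≤-refl)) sorted valid a≤n noSquare

module _ {n : ℕ} (G : SimpleGraph n) where

  lowerAdj : Fin n → Fin n → Bool
  lowerAdj a b = (toℕ b <ᵇ toℕ a) ∧ adj G a b

  arrayColumns : Fin n → List (ℕ × ℕ)
  arrayColumns a = map (λ b → suc (toℕ a) , suc (toℕ b)) (filterᵇ (lowerAdj a) (reverse (allFin n)))

  burgeArray-sorted : AllPairs BurgeBefore (burgeArray G)
  burgeArray-sorted = AllPairs.concat⁺ (All.map⁺ (All.universal columns-sorted _))
    (AllPairs.map⁺ (AllPairs.tabulate⁺-< λ {i} {j} i<j → between i j i<j))
    where
    columns-sorted : ∀ a → AllPairs BurgeBefore (arrayColumns a)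
    columns-sorted a = AllPairs.map⁺ (AllPairs.map (λ lt → inj₂ (refl , s≤s lt))
      (AllPairs.filter⁺ (T? ∘ lowerAdj a) (allPairs-reverse (AllPairs.tabulate⁺-< id))))

    tops : ∀ a → All ((_≡ suc (toℕ a)) ∘ proj₁) (arrayColumns a)
    tops a = All.map⁺ (All.universal (λ _ → refl) _)

    between : ∀ i j → toℕ i < toℕ j → All (λ p → All (BurgeBefore p) (arrayColumns j)) (arrayColumns i)
    between i j i<j = All.map (λ ≡i → All.map (λ ≡j → inj₁ (subst₂ _<_ (sym ≡i) (sym ≡j) (s≤s i<j))) (tops j)) (tops i)

  burgeArray-edgeColumns : All (EdgeColumn n) (burgeArray G)
  burgeArray-edgeColumns = All.concat⁺ {xss = map arrayColumns (allFin n)} (All.map⁺ (All.universal columns-valid _))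
    where
    columns-valid : ∀ a → All (EdgeColumn n) (arrayColumns a)
    columns-valid a = All.map⁺ (All.map (λ {b} t → s≤s z≤n , s≤s (<ᵇ⇒< _ _ (proj₁ (Equivalence.to T-∧ t))) , toℕ<n a)
      (All.all-filter (T? ∘ lowerAdj a) (reverse (allFin n))))

edgeCount : ∀ {n} → SimpleGraph n → ℕ
edgeCount {n} G = ∑[ a < n ] ∑[ b < n ] indicator (lowerAdj G a b)

length-burgeArray : ∀ {n} (G : SimpleGraph n) → length (burgeArray G) ≡ edgeCount G
length-burgeArray {n} G = trans (length-concatMap-tabulate (arrayColumns G) id) (sum-cong-≗ λ a → begin
  length (arrayColumns G a)                              ≡⟨ length-map _ (filterᵇ (lowerAdj G a) (reverse (allFin n))) ⟩
  length (filterᵇ (lowerAdj G a) (reverse (allFin n)))   ≡⟨ ↭-length (filter-↭ (T? ∘ lowerAdj G a) (↭-reverse (allFin n))) ⟩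
  length (filterᵇ (lowerAdj G a) (allFin n))             ≡⟨ length-filterᵇ-tabulate (lowerAdj G a) id ⟩
  ∑[ b < n ] indicator (lowerAdj G a b)                  ∎)
  where open ≡-Reasoning

hookGraph-edgeCount< : ∀ {n} (G : SimpleGraph n) → IsHookGraph G → 0 < n → edgeCount G < n
hookGraph-edgeCount< {n} G hook 0<n = subst (_< n) (length-burgeArray G)
  (hookArray-length< (burgeArray G) (burgeArray-sorted G) (burgeArray-edgeColumns G) hook 0<n)

-- Edge counts of connected graphs

deleteZero : ∀ {n} → SimpleGraph (suc n) → SimpleGraph n
deleteZero G = record
  { adj = λ u v → adj G (suc u) (suc v)
  ; symmetric = λ u v → symmetric G (suc u) (suc v)
  ; irreflexive = λ v → irreflexive G (suc v)
  }

degreeZero : ∀ {n} → SimpleGraph (suc n) → ℕ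
degreeZero {n} G = ∑[ v < n ] indicator (adj G (suc v) zero)

-- Row a = 0 of the edge sum is empty, and column b = 0 of the other rows counts the neighbours of 0.
edgeCount-deleteZero : ∀ {n} (G : SimpleGraph (suc n)) → edgeCount G ≡ degreeZero G + edgeCount (deleteZero G)
edgeCount-deleteZero {n} G =
  trans (cong (_+ (∑[ a < n ] ∑[ b < suc n ] indicator (lowerAdj G (suc a) b))) (sum-replicate-zero (suc n)))
        (∑-distrib-+ (λ a → indicator (adj G (suc a) zero)) (λ a → ∑[ b < n ] indicator (lowerAdj (deleteZero G) a b)))

WalksInto : ∀ {n} → SimpleGraph n → List (Fin n) → Set
WalksInto {n} G roots = ∀ u → ∃[ s ] s ∈ roots × Walk G u s

dropZero : ∀ {n} → List (Fin (suc n)) → List (Fin n)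
dropZero [] = []
dropZero (zero ∷ vs) = dropZero vs
dropZero (suc v ∷ vs) = v ∷ dropZero vs

∈-dropZero : ∀ {n} {v : Fin n} vs → suc v ∈ vs → v ∈ dropZero vs
∈-dropZero (zero ∷ vs) (there v∈) = ∈-dropZero vs v∈
∈-dropZero (suc _ ∷ vs) (here refl) = here refl
∈-dropZero (suc _ ∷ vs) (there v∈) = there (∈-dropZero vs v∈)

length-dropZero : ∀ {n} (vs : List (Fin (suc n))) → length (dropZero vs) ≤ length vs
length-dropZero [] = z≤n
length-dropZero (zero ∷ vs) = m≤n⇒m≤1+n (length-dropZero vs)
length-dropZero (suc _ ∷ vs) = s≤s (length-dropZero vs)

-- Make 0 a root, then delete it: walks through 0 now stop at a neighbour of 0, so the roots
-- grow by at most deg 0 − 1 while the edges drop by deg 0.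
walksInto-edgeCount : ∀ {n} (G : SimpleGraph n) roots → WalksInto G roots → n ≤ edgeCount G + length roots
walksInto-edgeCount {zero} G roots _ = z≤n
walksInto-edgeCount {suc n} G roots walks with walks zero
... | s₀ , s₀∈roots , zero⇝s₀ = begin
  suc n                                               ≤⟨ s≤s (walksInto-edgeCount (deleteZero G) roots⁻ walks⁻) ⟩
  suc (edgeCount G⁻ + length roots⁻)                  ≡⟨ cong (λ m → suc (edgeCount G⁻ + m)) (length-++ (dropZero others)) ⟩
  suc (edgeCount G⁻ + (length (dropZero others) + length neighbours))
    ≤⟨ s≤s (+-monoʳ-≤ (edgeCount G⁻) (+-monoˡ-≤ (length neighbours) (length-dropZero others))) ⟩
  suc (edgeCount G⁻ + (length others + length neighbours))
    ≡⟨ cong (λ d → suc (edgeCount G⁻ + (length others + d))) (length-filterᵇ-tabulate (λ v → adj G (suc v) zero) id) ⟩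
  suc (edgeCount G⁻ + (length others + degreeZero G))  ≡⟨ rearrange (edgeCount G⁻) (length others) (degreeZero G) ⟩
  degreeZero G + edgeCount G⁻ + suc (length others)   ≤⟨ +-monoʳ-≤ (degreeZero G + edgeCount G⁻) others<roots ⟩
  degreeZero G + edgeCount G⁻ + length roots          ≡⟨ cong (_+ length roots) (edgeCount-deleteZero G) ⟨
  edgeCount G + length roots                          ∎
  where
  open ≤-Reasoning

  G⁻ : SimpleGraph n
  G⁻ = deleteZero G

  others : List (Fin (suc n))
  others = filter (λ s → ¬? (s ≟ s₀)) roots

  neighbours : List (Fin n)
  neighbours = filterᵇ (λ v → adj G (suc v) zero) (allFin n)

  roots⁻ : List (Fin n)
  roots⁻ = dropZero others ++ neighbours

  others<roots : length others < length roots
  others<roots = filter-notAll (λ s → ¬? (s ≟ s₀)) roots (Any.map (λ s₀≡s s≢s₀ → s≢s₀ (sym s₀≡s)) s₀∈roots)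

  walks₀ : WalksInto G (zero ∷ others)
  walks₀ u with walks u
  ... | t , t∈roots , u⇝t with t ≟ s₀
  ...   | yes refl = zero , here refl , u⇝t ++ʷ reverseʷ zero⇝s₀
  ...   | no t≢s₀ = t , there (∈-filter⁺ (λ s → ¬? (s ≟ s₀)) t∈roots t≢s₀) , u⇝t

  restrict : ∀ {u t} → Walk G (suc u) t → t ∈ zero ∷ others → ∃[ s ] s ∈ roots⁻ × Walk G⁻ u s
  restrict {u} nil (there u∈others) = u , ∈-++⁺ˡ (∈-dropZero others u∈others) , nil
  restrict {u} (cons {v = zero} e _) _ =
    u , ∈-++⁺ʳ (dropZero others) (∈-filter⁺ (T? ∘ λ v → adj G (suc v) zero) (∈-allFin u) (subst T (sym e) tt)) , nil
  restrict (cons {v = suc _} e w) t∈ with restrict w t∈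
  ... | s , s∈ , w⁻ = s , s∈ , cons e w⁻

  walks⁻ : WalksInto G⁻ roots⁻
  walks⁻ u with walks₀ (suc u)
  ... | t , t∈ , w = restrict w t∈

  rearrange : ∀ e l d → suc (e + (l + d)) ≡ d + e + suc l
  rearrange = solve-∀

-- Deleting an edge of a cycle

SameEdge : ∀ {n} → Fin n → Fin n → Fin n → Fin n → Set
SameEdge x y u v = (u ≡ x × v ≡ y) ⊎ (u ≡ y × v ≡ x)

sameEdge? : ∀ {n} (x y u v : Fin n) → Dec (SameEdge x y u v)
sameEdge? x y u v = (u ≟ x ×-dec v ≟ y) ⊎-dec (u ≟ y ×-dec v ≟ x)

sameEdge-sym : ∀ {n} {x y u v : Fin n} → SameEdge x y u v → SameEdge x y v u
sameEdge-sym = [ inj₂ ∘ swap , inj₁ ∘ swap ]′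

deleteEdge : ∀ {n} → SimpleGraph n → Fin n → Fin n → SimpleGraph n
deleteEdge G x y = record
  { adj = λ u v → adj G u v ∧ not (does (sameEdge? x y u v))
  ; symmetric = λ u v → cong₂ _∧_ (symmetric G u v) (cong not (does-⇔ (mk⇔ sameEdge-sym sameEdge-sym) (sameEdge? x y u v) (sameEdge? x y v u)))
  ; irreflexive = λ v → cong (_∧ _) (irreflexive G v)
  }

deleteEdge-adj : ∀ {n} {G : SimpleGraph n} {x y u v} → ¬ SameEdge x y u v → Adj G u v → Adj (deleteEdge G x y) u v
deleteEdge-adj {x = x} {y} {u} {v} ¬same uv = cong₂ (λ p q → p ∧ not q) uv (dec-false (sameEdge? x y u v) ¬same)

rerouteWalk : ∀ {n} {G : SimpleGraph n} {x y u v} → Walk (deleteEdge G x y) y x → Walk G u v → Walk (deleteEdge G x y) u v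
rerouteWalk detour nil = nil
rerouteWalk {G = G} {x} {y} detour (cons {u} {w} e rest) with sameEdge? x y u w
... | yes (inj₁ (refl , refl)) = reverseʷ detour ++ʷ rerouteWalk detour rest
... | yes (inj₂ (refl , refl)) = detour ++ʷ rerouteWalk detour rest
... | no ¬same = cons (deleteEdge-adj {G = G} ¬same e) (rerouteWalk detour rest)

edgeCount-deleteEdge-at : ∀ {n} (G : SimpleGraph n) {x y hi lo} → SameEdge x y hi lo → toℕ lo < toℕ hi → Adj G hi lo →
                          edgeCount (deleteEdge G x y) < edgeCount G
edgeCount-deleteEdge-at G {x} {y} {hi} {lo} same lo<hi e =
  ∑-mono-< (λ a → ∑-mono-≤ (pointwise a)) hi (∑-mono-< (pointwise hi) lo deleted)
  where
  pointwise : ∀ a b → indicator (lowerAdj (deleteEdge G x y) a b) ≤ indicator (lowerAdj G a b)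
  pointwise a b = indicator-∧-≤ (toℕ b <ᵇ toℕ a) (adj G a b) _

  lo<ᵇhi : (toℕ lo <ᵇ toℕ hi) ≡ true
  lo<ᵇhi = Equivalence.to T-≡ (<⇒<ᵇ lo<hi)

  deleted : indicator (lowerAdj (deleteEdge G x y) hi lo) < indicator (lowerAdj G hi lo)
  deleted = subst₂ (λ p q → indicator p < indicator q)
    (sym (cong₂ _∧_ lo<ᵇhi (cong₂ (λ p q → p ∧ not q) e (dec-true (sameEdge? x y hi lo) same))))
    (sym (cong₂ _∧_ lo<ᵇhi e)) ≤-refl

edgeCount-deleteEdge : ∀ {n} (G : SimpleGraph n) {x y} → Adj G x y → x ≢ y → edgeCount (deleteEdge G x y) < edgeCount G
edgeCount-deleteEdge G {x} {y} xy x≢y with <-cmp (toℕ x) (toℕ y)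
... | tri< x<y _ _ = edgeCount-deleteEdge-at G (inj₂ (refl , refl)) x<y (trans (symmetric G y x) xy)
... | tri≈ _ x≡y _ = ⊥-elim (x≢y (toℕ-injective x≡y))
... | tri> _ _ y<x = edgeCount-deleteEdge-at G (inj₁ (refl , refl)) y<x xy

notSameEdge : ∀ {n} {x y u v : Fin n} → x ≢ u → y ≢ u → ¬ SameEdge x y u v
notSameEdge x≢u _ (inj₁ (u≡x , _)) = x≢u (sym u≡x)
notSameEdge _ y≢u (inj₂ (u≡y , _)) = y≢u (sym u≡y)

closedChain-walk : ∀ {n} {G : SimpleGraph n} {x y w} ws → ClosedChain G x (w ∷ ws) →
                   All (x ≢_) (w ∷ ws) → All (y ≢_) (w ∷ ws) → Walk (deleteEdge G x y) w x
closedChain-walk {G = G} [] wx (x≢w ∷ _) (y≢w ∷ _) = cons (deleteEdge-adj {G = G} (notSameEdge x≢w y≢w) wx) nil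
closedChain-walk {G = G} (_ ∷ ws) (ww′ , chain) (x≢w ∷ x≢ws) (y≢w ∷ y≢ws) =
  cons (deleteEdge-adj {G = G} (notSameEdge x≢w y≢w) ww′) (closedChain-walk ws chain x≢ws y≢ws)

cycle-detour : ∀ {n} {G : SimpleGraph n} {x y z} vs → IsCycle G (x ∷ y ∷ z ∷ vs) → Walk (deleteEdge G x y) y x
cycle-detour {G = G} {x} {y} {z} vs (((x≢y ∷ x≢z ∷ x≢vs) ∷ (y≢z ∷ y≢vs) ∷ _) , _ , yz , chain) =
  cons (deleteEdge-adj {G = G} ¬same yz) (closedChain-walk vs chain (x≢z ∷ x≢vs) (y≢z ∷ y≢vs))
  where
  ¬same : ¬ SameEdge x y y z
  ¬same = [ (λ (y≡x , _) → x≢y (sym y≡x)) , (λ (_ , z≡x) → x≢z (sym z≡x)) ]′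

connected-cycle-edgeCount : ∀ {n} (G : SimpleGraph n) {x y z} vs → Connected G → IsCycle G (x ∷ y ∷ z ∷ vs) → n ≤ edgeCount G
connected-cycle-edgeCount {n} G {x} {y} vs connected cycle@(((x≢y ∷ _) ∷ _) , xy , _) = begin
  n                                  ≤⟨ walksInto-edgeCount G′ [ x ] (λ u → x , here refl , rerouteWalk (cycle-detour vs cycle) (connected u x)) ⟩
  edgeCount G′ + 1                   ≡⟨ +-comm (edgeCount G′) 1 ⟩
  suc (edgeCount G′)                 ≤⟨ edgeCount-deleteEdge G xy x≢y ⟩
  edgeCount G                        ∎
  where
  open ≤-Reasoning

  G′ : SimpleGraph n
  G′ = deleteEdge G x y

mainTheorem4 : (n : ℕ) (G : SimpleGraph n) → Connected G → IsHookGraph G → IsTree G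
mainTheorem4 n G connected hook = connected , acyclic
  where
  acyclic : Acyclic G
  acyclic (x ∷ y ∷ z ∷ vs) cycle =
    <⇒≱ (hookGraph-edgeCount< G hook (≤-<-trans z≤n (toℕ<n x))) (connected-cycle-edgeCount G vs connected cycle)
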